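{- Let $p$ be a prime, $q$ a positive integer, and $A\in\{ -1,1\}^{q\times q}$. Let $r$ be a positive integer with $r\le q$ and $\delta\in(0,1/2)$, and suppose $\mathcal{R}^{\mathrm{bool},p}_{A}(r)\le\delta q^2$. Suppose further that the fraction of entries of $A$ equal to $1$ and the fraction equal to $-1$ differ by at most $\alpha\in(0,1)$, where $2\alpha+\delta<1/2$. Then for every positive integer $n$, $$\mathcal{R}^{\mathrm{bool},p}_{A^{\otimes n}}(2rn)\;\le\;q^{2n}\left(\frac12-\frac12\left(\frac12-\alpha-\delta\right)^n\right).$$
   Context: $\mathbb{F}_p$ is the field with $p$ elements. For $x\in\mathbb{F}_p$ define $\mathrm{bool}(x)=1$ if $x=1$ in $\mathbb{F}_p$ and $\mathrm{bool}(x)=-1$ otherwise. For $A\in\{ -1,1\}^{N\times N}$ and an integer $r\ge0$, the Boolean rigidity $\mathcal{R}^{\mathrm{bool},p}_{A}(r)$ is the minimum, over all $L\in\mathbb{F}_p^{N\times N}$ with $\mathbb{F}_p$-rank at most $r$, of the number of pairs $(i,j)$ with $A[i,j]\neq\mathrm{bool}(L[i,j])$. The Kronecker power $A^{\otimes n}$ is the $q^n\times q^n$ matrix indexed by $\{0,\dots,q-1\}^n$ with $A^{\otimes n}[x,y]=\prod_{i=1}^n A[x_i,y_i]$.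
   Formalization: The parameters α and δ range over the rationals. -}

module Defs where

open import Data.Nat as ℕ using (ℕ; zero; suc; _%_)
open import Data.Bool using (Bool; true; false; if_then_else_)
open import Data.Fin using (Fin; toℕ)
open import Data.Vec using (Vec; []; _∷_)
open import Data.List using (List; []; _∷_; allFin; concatMap; map)
open import Data.Integer using (+_)
open import Data.Rational using (ℚ; _/_; _*_; 0ℚ; 1ℚ)

data Sign : Set where
  plus  : Sign
  minus : Sign

_·_ : Sign → Sign → Sign
plus  · s = s
minus · plus = minus
minus · minus = plus

_==_ : Sign → Sign → Bool
plus == plus = true
minus == minus = true
_ == _ = false

SMat : Set → Set
SMat I = I → I → Sign

kron : ∀ {q} → SMat (Fin q) → (n : ℕ) → SMat (Vec (Fin q) n)
kron A zero    []       []       = plus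
kron A (suc n) (x ∷ xs) (y ∷ ys) = A x y · kron A n xs ys

allVecs : (q n : ℕ) → List (Vec (Fin q) n)
allVecs q zero    = [] ∷ []
allVecs q (suc n) = concatMap (λ x → map (x ∷_) (allVecs q n)) (allFin q)

count : ∀ {I : Set} → (I → Bool) → List I → ℕ
count P []       = 0
count P (x ∷ xs) = if P x then suc (count P xs) else count P xs

countPairs : ∀ {I : Set} → List I → (I → I → Bool) → ℕ
countPairs is P = count (λ ij → P (Data.Product.proj₁ ij) (Data.Product.proj₂ ij))
                    (concatMap (λ i → map (λ j → i Data.Product., j) is) is)
  where import Data.Product

sumFin : (r : ℕ) → (Fin r → ℕ) → ℕ
sumFin zero    f = 0
sumFin (suc r) f = f Fin.zero ℕ.+ sumFin r (λ k → f (Fin.suc k))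
  where import Data.Fin as Fin

-- bool : F_p → {-1,1}; elements of F_p are represented by naturals mod p
boolp : (p : ℕ) → ℕ → Sign
boolp zero    x = minus   -- never used (p is prime)
boolp (suc p) x = if (x % suc p) ℕ.≡ᵇ 1 then plus else minus

-- The F_p matrix L = U V (entries as naturals, reduced mod p inside boolp):
-- every matrix of F_p-rank ≤ r is of this form, and conversely.
prodMat : ∀ {I : Set} (p r : ℕ) → (I → Fin r → Fin p) → (Fin r → I → Fin p) → I → I → ℕ
prodMat p r U V i j = sumFin r (λ k → toℕ (U i k) ℕ.* toℕ (V k j))

mismatches : ∀ {I : Set} → List I → (p : ℕ) → SMat I → (I → I → ℕ) → ℕ
mismatches is p A L = countPairs is (λ i j → if A i j == boolp p (L i j) then false else true)

-- R^{bool,p}_A(r) ≤ B  (the rigidity is a minimum over a finite set, so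
-- "min ≤ B" is "some admissible L achieves ≤ B")
RigidityAtMost : ∀ {I : Set} → List I → (p : ℕ) → SMat I → (r : ℕ) → ℚ → Set
RigidityAtMost {I} is p A r B =
  Data.Product.Σ (I → Fin r → Fin p) λ U →
  Data.Product.Σ (Fin r → I → Fin p) λ V →
  toℚ (mismatches is p A (prodMat p r U V)) Data.Rational.≤ B
  where
  import Data.Product
  toℚ : ℕ → ℚ
  toℚ n = (+ n) / 1

ℕtoℚ : ℕ → ℚ
ℕtoℚ n = (+ n) / 1

_over_ : ℕ → ℕ → ℚ
n over zero  = 0ℚ
n over suc d = (+ n) / suc d

_^ℚ_ : ℚ → ℕ → ℚ
x ^ℚ zero  = 1ℚ
x ^ℚ suc n = x * (x ^ℚ n)

entriesEqual : ∀ {q} → SMat (Fin q) → Sign → ℕ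
entriesEqual {q} A s = countPairs (allFin q) (λ i j → A i j == s)

{-# OPTIONS --safe #-}
module Submission where

-- Let L = U₀V₀ be the rank-r matrix over 𝔽ₚ whose Boolean pattern has at most δq² mismatches with A,
-- and call g = Σ_{a,b} A[a,b]·[L[a,b] = 1] = #(+1 entries of A) - #mismatches ≥ q²(½ - α - δ) its gain.
-- For t ∈ 𝔽ₚⁿ the matrix M_t[x,y] = 1 + Σᵢ tᵢ(L[xᵢ,yᵢ] - 1) has rank at most nr + 1, and bool(M_t) = +1
-- exactly where the sum vanishes.  The character sum Σ_{s ∈ 𝔽ₚ} (p[s·e + w = 0] - 1) = p[e = 0](p[w = 0] - 1)
-- shows that the potential E(t) = Σ_{x,y} A^⊗n[x,y](p[M_t[x,y] = 1] - 1), summed over the first coordinate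
-- of t, equals p·g·E of the remaining coordinates; since E() = p - 1, some t has E(t) ≥ (p - 1)gⁿ.
-- Then bool(M_t) or the all-ones matrix has correlation at least gⁿ with A^⊗n, that is at most
-- (q²ⁿ - gⁿ)/2 mismatches.

open import Data.Nat using (ℕ)
open import Data.Nat.Primality using (Prime)
open import Data.Fin using (Fin)
open import Defs

module Sums where

  open import Data.Nat using (ℕ; zero; suc)
  import Data.Nat as ℕ
  import Data.Nat.Properties as ℕ
  open import Data.Integer using (ℤ; +_; 0ℤ; 1ℤ; _+_; _*_; _-_; _≤_)
  import Data.Integer.Properties as ℤ
  open import Data.Bool using (Bool; true; false)
  open import Data.Fin as Fin using (Fin)
  import Data.Fin.Properties as Fin
  open import Data.List using (List; []; _∷_; _++_; map; concatMap; allFin)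
  open import Data.List.Properties using (map-tabulate)
  open import Data.Vec using (Vec; _∷_)
  open import Data.Product using (_,_; ∃)
  open import Relation.Nullary using (yes; no)
  open import Function using (_∘_)
  open import Relation.Binary.PropositionalEquality
  open import Data.Integer.Tactic.RingSolver using (solve-∀)

  ∑ : {X : Set} → List X → (X → ℤ) → ℤ
  ∑ []       f = 0ℤ
  ∑ (x ∷ xs) f = f x + ∑ xs f

  infix 5 ∑
  syntax ∑ xs (λ x → e) = ∑[ x ← xs ] e

  ∑∑ : {I : Set} → List I → (I → I → ℤ) → ℤ
  ∑∑ is f = ∑[ x ← is ] ∑[ y ← is ] f x y

  𝟙 : Bool → ℤ
  𝟙 true  = 1ℤ
  𝟙 false = 0ℤ

  module _ {X : Set} where

    ∑-cong : ∀ (xs : List X) {f g : X → ℤ} → (∀ x → f x ≡ g x) → ∑ xs f ≡ ∑ xs g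
    ∑-cong []       f≗g = refl
    ∑-cong (x ∷ xs) f≗g = cong₂ _+_ (f≗g x) (∑-cong xs f≗g)

    ∑-mono : ∀ (xs : List X) {f g : X → ℤ} → (∀ x → f x ≤ g x) → ∑ xs f ≤ ∑ xs g
    ∑-mono []       f≤g = ℤ.≤-refl
    ∑-mono (x ∷ xs) f≤g = ℤ.+-mono-≤ (f≤g x) (∑-mono xs f≤g)

    ∑-zero : ∀ (xs : List X) → ∑[ x ← xs ] 0ℤ ≡ 0ℤ
    ∑-zero []       = refl
    ∑-zero (x ∷ xs) = trans (ℤ.+-identityˡ _) (∑-zero xs)

    ∑-+ : ∀ (xs : List X) (f g : X → ℤ) → ∑[ x ← xs ] (f x + g x) ≡ ∑ xs f + ∑ xs g
    ∑-+ []       f g = refl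
    ∑-+ (x ∷ xs) f g = trans (cong (_+_ (f x + g x)) (∑-+ xs f g)) (interchange (f x) (g x) _ _)
      where
      interchange : ∀ a b c d → (a + b) + (c + d) ≡ (a + c) + (b + d)
      interchange = solve-∀

    ∑-- : ∀ (xs : List X) (f g : X → ℤ) → ∑[ x ← xs ] (f x - g x) ≡ ∑ xs f - ∑ xs g
    ∑-- []       f g = refl
    ∑-- (x ∷ xs) f g = trans (cong (_+_ (f x - g x)) (∑-- xs f g)) (interchange (f x) (g x) _ _)
      where
      interchange : ∀ a b c d → (a - b) + (c - d) ≡ (a + c) - (b + d)
      interchange = solve-∀

    ∑-*ˡ : ∀ (xs : List X) c (f : X → ℤ) → ∑[ x ← xs ] (c * f x) ≡ c * ∑ xs f
    ∑-*ˡ []       c f = sym (ℤ.*-zeroʳ c)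
    ∑-*ˡ (x ∷ xs) c f = trans (cong (_+_ (c * f x)) (∑-*ˡ xs c f)) (sym (ℤ.*-distribˡ-+ c (f x) _))

    ∑-*ʳ : ∀ (xs : List X) c (f : X → ℤ) → ∑[ x ← xs ] (f x * c) ≡ ∑ xs f * c
    ∑-*ʳ []       c f = sym (ℤ.*-zeroˡ c)
    ∑-*ʳ (x ∷ xs) c f = trans (cong (_+_ (f x * c)) (∑-*ʳ xs c f)) (sym (ℤ.*-distribʳ-+ c (f x) _))

    ∑-++ : ∀ (xs ys : List X) (f : X → ℤ) → ∑ (xs ++ ys) f ≡ ∑ xs f + ∑ ys f
    ∑-++ []       ys f = sym (ℤ.+-identityˡ _)
    ∑-++ (x ∷ xs) ys f = trans (cong (_+_ (f x)) (∑-++ xs ys f)) (sym (ℤ.+-assoc (f x) _ _))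

  module _ {X Y : Set} where

    ∑-map : ∀ (xs : List X) (g : X → Y) (f : Y → ℤ) → ∑ (map g xs) f ≡ ∑ xs (f ∘ g)
    ∑-map []       g f = refl
    ∑-map (x ∷ xs) g f = cong (_+_ (f (g x))) (∑-map xs g f)

    ∑-concatMap : ∀ (xs : List X) (g : X → List Y) (f : Y → ℤ) →
                  ∑ (concatMap g xs) f ≡ ∑[ x ← xs ] ∑ (g x) f
    ∑-concatMap []       g f = refl
    ∑-concatMap (x ∷ xs) g f =
      trans (∑-++ (g x) (concatMap g xs) f) (cong (_+_ (∑ (g x) f)) (∑-concatMap xs g f))

    ∑-comm : ∀ (xs : List X) (ys : List Y) (f : X → Y → ℤ) →
             ∑[ x ← xs ] ∑[ y ← ys ] f x y ≡ ∑[ y ← ys ] ∑[ x ← xs ] f x y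
    ∑-comm []       ys f = sym (∑-zero ys)
    ∑-comm (x ∷ xs) ys f =
      trans (cong (_+_ (∑ ys (f x))) (∑-comm xs ys f)) (sym (∑-+ ys (f x) _))

  ∑-allFin-suc : ∀ n (f : Fin (suc n) → ℤ) →
                 ∑ (allFin (suc n)) f ≡ f Fin.zero + (∑[ i ← allFin n ] f (Fin.suc i))
  ∑-allFin-suc n f = cong (_+_ (f Fin.zero))
    (trans (cong (λ is → ∑ is f) (sym (map-tabulate (λ i → i) Fin.suc))) (∑-map (allFin n) Fin.suc f))

  ∑-const : ∀ n c → ∑[ _ ← allFin n ] c ≡ + n * c
  ∑-const zero    c = sym (ℤ.*-zeroˡ c)
  ∑-const (suc n) c = trans (∑-allFin-suc n (λ _ → c)) (trans (cong (_+_ c) (∑-const n c)) (lemma (+ n) c))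
    where
    lemma : ∀ a c → c + a * c ≡ (1ℤ + a) * c
    lemma = solve-∀

  ∑-𝟙-unique : ∀ n (P : Fin n → Bool) t₀ → P t₀ ≡ true → (∀ t → P t ≡ true → t ≡ t₀) →
               ∑[ t ← allFin n ] 𝟙 (P t) ≡ 1ℤ
  ∑-𝟙-unique (suc n) P Fin.zero P-zero unique = begin
    ∑[ t ← allFin (suc n) ] 𝟙 (P t)                    ≡⟨ ∑-allFin-suc n (𝟙 ∘ P) ⟩
    𝟙 (P Fin.zero) + (∑[ t ← allFin n ] 𝟙 (P (Fin.suc t)))
      ≡⟨ cong₂ _+_ (cong 𝟙 P-zero) (trans (∑-cong (allFin n) (cong 𝟙 ∘ P-suc)) (∑-zero (allFin n))) ⟩
    1ℤ + 0ℤ                                              ∎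
    where
    open ≡-Reasoning
    P-suc : ∀ t → P (Fin.suc t) ≡ false
    P-suc t with P (Fin.suc t) in P-t
    ... | true  with () ← unique (Fin.suc t) P-t
    ... | false = refl
  ∑-𝟙-unique (suc n) P (Fin.suc t₀) P-t₀ unique = begin
    ∑[ t ← allFin (suc n) ] 𝟙 (P t)                        ≡⟨ ∑-allFin-suc n (𝟙 ∘ P) ⟩
    𝟙 (P Fin.zero) + (∑[ t ← allFin n ] 𝟙 (P (Fin.suc t)))
      ≡⟨ cong₂ _+_ (cong 𝟙 P-zero) (∑-𝟙-unique n (P ∘ Fin.suc) t₀ P-t₀ unique-suc) ⟩
    0ℤ + 1ℤ                                                  ∎
    where
    open ≡-Reasoning
    P-zero : P Fin.zero ≡ false
    P-zero with P Fin.zero in P-z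
    ... | true  with () ← unique Fin.zero P-z
    ... | false = refl
    unique-suc : ∀ t → P (Fin.suc t) ≡ true → t ≡ t₀
    unique-suc t P-t = Fin.suc-injective (unique (Fin.suc t) P-t)

  argmax : ∀ n (f : Fin (suc n) → ℤ) → ∃ λ t → ∀ s → f s ≤ f t
  argmax zero    f = Fin.zero , λ { Fin.zero → ℤ.≤-refl }
  argmax (suc n) f with argmax n (f ∘ Fin.suc)
  ... | t , f≤f[t] with f Fin.zero ℤ.≤? f (Fin.suc t)
  ...   | yes f₀≤ = Fin.suc t , λ { Fin.zero → f₀≤ ; (Fin.suc s) → f≤f[t] s }
  ...   | no  f₀≰ = Fin.zero , λ { Fin.zero → ℤ.≤-refl ; (Fin.suc s) → ℤ.≤-trans (f≤f[t] s) (ℤ.<⇒≤ (ℤ.≰⇒> f₀≰)) }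

  ∃-≥-average : ∀ n (f : Fin (suc n) → ℤ) Y → + suc n * Y ≤ ∑[ t ← allFin (suc n) ] f t → ∃ λ t → Y ≤ f t
  ∃-≥-average n f Y nY≤∑f with argmax n f
  ... | t , f≤f[t] = t , ℤ.*-cancelˡ-≤-pos Y (f t) (+ suc n)
        (ℤ.≤-trans nY≤∑f (ℤ.≤-trans (∑-mono (allFin (suc n)) f≤f[t]) (ℤ.≤-reflexive (∑-const (suc n) (f t)))))

  count-∑ : ∀ {X : Set} (P : X → Bool) xs → + count P xs ≡ ∑[ x ← xs ] 𝟙 (P x)
  count-∑ P []       = refl
  count-∑ P (x ∷ xs) with P x
  ... | true  = cong (_+_ 1ℤ) (count-∑ P xs)
  ... | false = trans (count-∑ P xs) (sym (ℤ.+-identityˡ _))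

  countPairs-∑∑ : ∀ {I : Set} (is : List I) P → + countPairs is P ≡ ∑∑ is (λ x y → 𝟙 (P x y))
  countPairs-∑∑ is P =
    trans (count-∑ _ (concatMap (λ i → map (i ,_) is) is))
          (trans (∑-concatMap is (λ i → map (i ,_) is) _) (∑-cong is (λ i → ∑-map is (i ,_) _)))

  module _ {I : Set} (is : List I) where

    ∑∑-cong : ∀ {f g : I → I → ℤ} → (∀ x y → f x y ≡ g x y) → ∑∑ is f ≡ ∑∑ is g
    ∑∑-cong f≗g = ∑-cong is (λ x → ∑-cong is (f≗g x))

    ∑∑-+ : ∀ (f g : I → I → ℤ) → ∑∑ is (λ x y → f x y + g x y) ≡ ∑∑ is f + ∑∑ is g
    ∑∑-+ f g = trans (∑-cong is (λ x → ∑-+ is (f x) (g x))) (∑-+ is _ _)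

    ∑∑-- : ∀ (f g : I → I → ℤ) → ∑∑ is (λ x y → f x y - g x y) ≡ ∑∑ is f - ∑∑ is g
    ∑∑-- f g = trans (∑-cong is (λ x → ∑-- is (f x) (g x))) (∑-- is _ _)

    ∑∑-*ˡ : ∀ c (f : I → I → ℤ) → ∑∑ is (λ x y → c * f x y) ≡ c * ∑∑ is f
    ∑∑-*ˡ c f = trans (∑-cong is (λ x → ∑-*ˡ is c (f x))) (∑-*ˡ is c _)

    ∑∑-*ʳ : ∀ c (f : I → I → ℤ) → ∑∑ is (λ x y → f x y * c) ≡ ∑∑ is f * c
    ∑∑-*ʳ c f = trans (∑-cong is (λ x → ∑-*ʳ is c (f x))) (∑-*ʳ is c _)

    ∑-∑∑-comm : ∀ {T : Set} (ts : List T) (F : T → I → I → ℤ) →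
                ∑[ t ← ts ] ∑∑ is (F t) ≡ ∑∑ is (λ x y → ∑[ t ← ts ] F t x y)
    ∑-∑∑-comm ts F = trans (∑-comm ts is _) (∑-cong is (λ x → ∑-comm ts is (λ t → F t x)))

  module _ (q : ℕ) where

    ∑-allVecs-suc : ∀ n (f : Vec (Fin q) (suc n) → ℤ) →
                    ∑ (allVecs q (suc n)) f ≡ ∑[ a ← allFin q ] ∑[ xs ← allVecs q n ] f (a ∷ xs)
    ∑-allVecs-suc n f = trans (∑-concatMap (allFin q) (λ a → map (a ∷_) (allVecs q n)) f)
                              (∑-cong (allFin q) (λ a → ∑-map (allVecs q n) (a ∷_) f))

    ∑∑-allVecs-suc : ∀ n (f : Vec (Fin q) (suc n) → Vec (Fin q) (suc n) → ℤ) →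
                     ∑∑ (allVecs q (suc n)) f ≡
                     ∑∑ (allFin q) (λ a b → ∑∑ (allVecs q n) (λ xs ys → f (a ∷ xs) (b ∷ ys)))
    ∑∑-allVecs-suc n f = begin
      ∑[ x ← allVecs q (suc n) ] ∑[ y ← allVecs q (suc n) ] f x y
        ≡⟨ ∑-allVecs-suc n _ ⟩
      ∑[ a ← allFin q ] ∑[ xs ← allVecs q n ] ∑[ y ← allVecs q (suc n) ] f (a ∷ xs) y
        ≡⟨ ∑-cong (allFin q) (λ a → ∑-cong (allVecs q n) (λ xs → ∑-allVecs-suc n _)) ⟩
      ∑[ a ← allFin q ] ∑[ xs ← allVecs q n ] ∑[ b ← allFin q ] ∑[ ys ← allVecs q n ] f (a ∷ xs) (b ∷ ys)
        ≡⟨ ∑-cong (allFin q) (λ a → ∑-comm (allVecs q n) (allFin q) _) ⟩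
      ∑[ a ← allFin q ] ∑[ b ← allFin q ] ∑[ xs ← allVecs q n ] ∑[ ys ← allVecs q n ] f (a ∷ xs) (b ∷ ys)
        ∎
      where open ≡-Reasoning

    ∑-one-allVecs : ∀ n → ∑[ _ ← allVecs q n ] 1ℤ ≡ + (q ℕ.^ n)
    ∑-one-allVecs zero    = refl
    ∑-one-allVecs (suc n) = begin
      ∑[ _ ← allVecs q (suc n) ] 1ℤ     ≡⟨ ∑-allVecs-suc n _ ⟩
      ∑[ _ ← allFin q ] ∑[ _ ← allVecs q n ] 1ℤ
                                        ≡⟨ ∑-cong (allFin q) (λ _ → ∑-one-allVecs n) ⟩
      ∑[ _ ← allFin q ] + (q ℕ.^ n)     ≡⟨ ∑-const q _ ⟩
      + q * + (q ℕ.^ n)                 ≡⟨ ℤ.pos-* q (q ℕ.^ n) ⟨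
      + (q ℕ.^ suc n)                   ∎
      where open ≡-Reasoning

    ∑∑-one-allVecs : ∀ n → ∑∑ (allVecs q n) (λ _ _ → 1ℤ) ≡ + (q ℕ.^ (2 ℕ.* n))
    ∑∑-one-allVecs n = begin
      ∑[ _ ← allVecs q n ] ∑[ _ ← allVecs q n ] 1ℤ
        ≡⟨ ∑-cong (allVecs q n) (λ _ → trans (∑-one-allVecs n) (sym (ℤ.*-identityˡ _))) ⟩
      ∑[ _ ← allVecs q n ] (1ℤ * + (q ℕ.^ n))
        ≡⟨ ∑-*ʳ (allVecs q n) _ (λ _ → 1ℤ) ⟩
      (∑[ _ ← allVecs q n ] 1ℤ) * + (q ℕ.^ n)
        ≡⟨ cong (_* + (q ℕ.^ n)) (∑-one-allVecs n) ⟩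
      + (q ℕ.^ n) * + (q ℕ.^ n)
        ≡⟨ ℤ.pos-* (q ℕ.^ n) _ ⟨
      + (q ℕ.^ n ℕ.* q ℕ.^ n)
        ≡⟨ cong +_ (ℕ.^-distribˡ-+-* q n n) ⟨
      + (q ℕ.^ (n ℕ.+ n))
        ≡⟨ cong (λ m → + (q ℕ.^ (n ℕ.+ m))) (ℕ.+-identityʳ n) ⟨
      + (q ℕ.^ (2 ℕ.* n))
        ∎
      where open ≡-Reasoning


module Correlation where

  open import Data.Nat as ℕ using (ℕ; zero; suc)
  open import Data.Integer using (ℤ; +_; -[1+_]; 1ℤ; _+_; _*_; _-_; _^_)
  import Data.Integer.Properties as ℤ
  open import Data.Bool using (Bool; true; false; if_then_else_)
  open import Data.Fin using (Fin)
  open import Data.Vec using (Vec; _∷_)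
  open import Data.List using (List; allFin)
  open import Relation.Binary.PropositionalEquality
  open Sums

  toℤ : Sign → ℤ
  toℤ plus  = 1ℤ
  toℤ minus = -[1+ 0 ]

  toℤ-· : ∀ s t → toℤ (s · t) ≡ toℤ s * toℤ t
  toℤ-· plus  t     = sym (ℤ.*-identityˡ (toℤ t))
  toℤ-· minus plus  = refl
  toℤ-· minus minus = refl

  correlation : {I : Set} → List I → SMat I → SMat I → ℤ
  correlation is A B = ∑∑ is (λ x y → toℤ (A x y) * toℤ (B x y))

  2*disagreements≡size-correlation : ∀ {I : Set} (is : List I) (A B : SMat I) →
    + (2 ℕ.* countPairs is (λ x y → if A x y == B x y then false else true)) ≡
    ∑∑ is (λ _ _ → 1ℤ) - correlation is A B
  2*disagreements≡size-correlation {I} is A B = begin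
    + (2 ℕ.* countPairs is differ)
      ≡⟨ ℤ.pos-* 2 (countPairs is differ) ⟩
    + 2 * + countPairs is differ
      ≡⟨ cong (+ 2 *_) (countPairs-∑∑ is differ) ⟩
    + 2 * ∑∑ is (λ x y → 𝟙 (differ x y))
      ≡⟨ ∑∑-*ˡ is (+ 2) _ ⟨
    ∑∑ is (λ x y → + 2 * 𝟙 (differ x y))
      ≡⟨ ∑∑-cong is (λ x y → entry (A x y) (B x y)) ⟩
    ∑∑ is (λ x y → 1ℤ - toℤ (A x y) * toℤ (B x y))
      ≡⟨ ∑∑-- is _ _ ⟩
    ∑∑ is (λ _ _ → 1ℤ) - correlation is A B
      ∎
    where
    open ≡-Reasoning
    differ : I → I → Bool
    differ x y = if A x y == B x y then false else true
    entry : ∀ s t → + 2 * 𝟙 (if s == t then false else true) ≡ 1ℤ - toℤ s * toℤ t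
    entry plus  plus  = refl
    entry plus  minus = refl
    entry minus plus  = refl
    entry minus minus = refl

  module _ {q : ℕ} (A : SMat (Fin q)) where

    total : ℤ
    total = ∑∑ (allFin q) (λ a b → toℤ (A a b))

    ∑∑-kron-suc : ∀ n (f : Vec (Fin q) (suc n) → Vec (Fin q) (suc n) → ℤ) →
      ∑∑ (allVecs q (suc n)) (λ x y → toℤ (kron A (suc n) x y) * f x y) ≡
      ∑∑ (allFin q) (λ a b → toℤ (A a b) * ∑∑ (allVecs q n) (λ x y → toℤ (kron A n x y) * f (a ∷ x) (b ∷ y)))
    ∑∑-kron-suc n f = trans (∑∑-allVecs-suc q n _) (∑∑-cong (allFin q) λ a b →
      trans (∑∑-cong (allVecs q n) (λ x y → split (A a b) (kron A n x y) (f (a ∷ x) (b ∷ y))))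
            (∑∑-*ˡ (allVecs q n) (toℤ (A a b)) (λ x y → toℤ (kron A n x y) * f (a ∷ x) (b ∷ y))))
      where
      split : ∀ s t z → toℤ (s · t) * z ≡ toℤ s * (toℤ t * z)
      split s t z = trans (cong (_* z) (toℤ-· s t)) (ℤ.*-assoc (toℤ s) (toℤ t) z)

    total-kron : ∀ n → ∑∑ (allVecs q n) (λ x y → toℤ (kron A n x y)) ≡ total ^ n
    total-kron zero    = refl
    total-kron (suc n) = begin
      ∑∑ (allVecs q (suc n)) (λ x y → toℤ (kron A (suc n) x y))
        ≡⟨ ∑∑-cong (allVecs q (suc n)) (λ x y → ℤ.*-identityʳ _) ⟨
      ∑∑ (allVecs q (suc n)) (λ x y → toℤ (kron A (suc n) x y) * 1ℤ)
        ≡⟨ ∑∑-kron-suc n (λ _ _ → 1ℤ) ⟩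
      ∑∑ (allFin q) (λ a b → toℤ (A a b) * ∑∑ (allVecs q n) (λ x y → toℤ (kron A n x y) * 1ℤ))
        ≡⟨ ∑∑-*ʳ (allFin q) _ _ ⟩
      total * ∑∑ (allVecs q n) (λ x y → toℤ (kron A n x y) * 1ℤ)
        ≡⟨ cong (total *_) (trans (∑∑-cong (allVecs q n) (λ x y → ℤ.*-identityʳ _)) (total-kron n)) ⟩
      total * total ^ n
        ∎
      where open ≡-Reasoning

    entries-plus+minus : + entriesEqual A plus + + entriesEqual A minus ≡ + (q ℕ.* q)
    entries-plus+minus = begin
      + entriesEqual A plus + + entriesEqual A minus
        ≡⟨ cong₂ _+_ (countPairs-∑∑ (allFin q) _) (countPairs-∑∑ (allFin q) _) ⟩
      ∑∑ (allFin q) (λ a b → 𝟙 (A a b == plus)) + ∑∑ (allFin q) (λ a b → 𝟙 (A a b == minus))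
        ≡⟨ ∑∑-+ (allFin q) _ _ ⟨
      ∑∑ (allFin q) (λ a b → 𝟙 (A a b == plus) + 𝟙 (A a b == minus))
        ≡⟨ ∑∑-cong (allFin q) (λ a b → one-sign (A a b)) ⟩
      ∑[ _ ← allFin q ] ∑[ _ ← allFin q ] 1ℤ
        ≡⟨ trans (∑-cong (allFin q) (λ _ → ∑-const q 1ℤ)) (∑-const q _) ⟩
      + q * (+ q * 1ℤ)
        ≡⟨ trans (cong (+ q *_) (ℤ.*-identityʳ (+ q))) (sym (ℤ.pos-* q q)) ⟩
      + (q ℕ.* q)
        ∎
      where
      open ≡-Reasoning
      one-sign : ∀ s → 𝟙 (s == plus) + 𝟙 (s == minus) ≡ 1ℤ
      one-sign plus  = refl
      one-sign minus = refl


module Modular (k : ℕ) where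

  open import Data.Nat using (ℕ; zero; suc; _+_; _*_; _%_; _/_; _≡ᵇ_; _≤_; _<_)
  open import Data.Nat.Properties
  open import Data.Nat.DivMod
  open import Data.Nat.Divisibility using (_∣_; m%n≡0⇒n∣m; n∣m⇒m%n≡0; ∣n⇒∣m*n; >⇒∤)
  open import Data.Nat.Primality using (Prime; euclidsLemma)
  import Data.Nat.Tactic.RingSolver as ℕ-Ring
  open import Data.Integer as ℤ using (ℤ; +_; 0ℤ; 1ℤ)
  import Data.Integer.Properties as ℤ
  open import Data.Bool using (true; false; T; if_then_else_)
  open import Data.Fin as Fin using (Fin; toℕ; fromℕ<; punchOut)
  import Data.Fin.Properties as Fin
  open import Data.List using (allFin)
  open import Data.Product using (_,_; ∃)
  open import Data.Sum using (inj₁; inj₂)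
  open import Data.Empty using (⊥-elim)
  open import Function using (_∘_)
  open import Relation.Nullary using (yes; no)
  open import Relation.Binary.PropositionalEquality
  open Sums

  -- Primes are written k + 2, so that _%_ and boolp compute on p.
  p : ℕ
  p = suc (suc k)

  boolp-cong : ∀ m m′ → m % p ≡ m′ % p → boolp p m ≡ boolp p m′
  boolp-cong m m′ m≡m′ = cong (λ r → if r ≡ᵇ 1 then plus else minus) m≡m′

  +-%-congˡ : ∀ c {x y} → x % p ≡ y % p → (c + x) % p ≡ (c + y) % p
  +-%-congˡ c {x} {y} x≡y = begin
    (c + x) % p              ≡⟨ %-distribˡ-+ c x p ⟩
    (c % p + x % p) % p      ≡⟨ cong (λ z → (c % p + z) % p) x≡y ⟩
    (c % p + y % p) % p      ≡⟨ %-distribˡ-+ c y p ⟨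
    (c + y) % p              ∎
    where open ≡-Reasoning

  +-%-cancelˡ : ∀ c x y → (c + x) % p ≡ (c + y) % p → x % p ≡ y % p
  +-%-cancelˡ c x y eq = begin
    x % p                       ≡⟨ [m+kn]%n≡m%n x ((c + y) / p) p ⟨
    (x + (c + y) / p * p) % p   ≡⟨ cong (_% p) (+-cancelˡ-≡ c _ _ balance) ⟩
    (y + (c + x) / p * p) % p   ≡⟨ [m+kn]%n≡m%n y ((c + x) / p) p ⟩
    y % p                       ∎
    where
    open ≡-Reasoning
    X Y : ℕ
    X = (c + x) / p * p
    Y = (c + y) / p * p
    shuffle : ∀ c x Y → c + (x + Y) ≡ (c + x) + Y
    shuffle = ℕ-Ring.solve-∀
    balance : c + (x + Y) ≡ c + (y + X)
    balance = begin
      c + (x + Y)                        ≡⟨ shuffle c x Y ⟩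
      (c + x) + Y                        ≡⟨ cong (_+ Y) (m≡m%n+[m/n]*n (c + x) p) ⟩
      ((c + x) % p + X) + Y              ≡⟨ cong (λ r → (r + X) + Y) eq ⟩
      ((c + y) % p + X) + Y              ≡⟨ +-assoc ((c + y) % p) X Y ⟩
      (c + y) % p + (X + Y)              ≡⟨ cong (_+_ ((c + y) % p)) (+-comm X Y) ⟩
      (c + y) % p + (Y + X)              ≡⟨ +-assoc ((c + y) % p) Y X ⟨
      ((c + y) % p + Y) + X              ≡⟨ cong (_+ X) (m≡m%n+[m/n]*n (c + y) p) ⟨
      (c + y) + X                        ≡⟨ shuffle c y X ⟨
      c + (y + X)                        ∎

  ≡ᵇ-cong : ∀ {a b c d} → (a ≡ b → c ≡ d) → (c ≡ d → a ≡ b) → (a ≡ᵇ b) ≡ (c ≡ᵇ d)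
  ≡ᵇ-cong {a} {b} {c} {d} ab⇒cd cd⇒ab with a ≡ᵇ b in ab | c ≡ᵇ d in cd
  ... | true  | true  = refl
  ... | false | false = refl
  ... | true  | false = ⊥-elim (subst T cd (≡⇒≡ᵇ c d (ab⇒cd (≡ᵇ⇒≡ a b (subst T (sym ab) _)))))
  ... | false | true  = ⊥-elim (subst T ab (≡⇒≡ᵇ a b (cd⇒ab (≡ᵇ⇒≡ c d (subst T (sym cd) _)))))

  suc-%≡1⇔%≡0 : ∀ w → (suc w % p ≡ᵇ 1) ≡ (w % p ≡ᵇ 0)
  suc-%≡1⇔%≡0 w = ≡ᵇ-cong (+-%-cancelˡ 1 w 0) (+-%-congˡ 1 {w} {0})

  [p-1+L]%≡0⇔%≡1 : ∀ L → ((suc k + L) % p ≡ᵇ 0) ≡ (L % p ≡ᵇ 1)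
  [p-1+L]%≡0⇔%≡1 L = ≡ᵇ-cong (λ eq → +-%-cancelˡ (suc k) L 1 (trans eq (sym p%p)))
                              (λ eq → trans (+-%-congˡ (suc k) eq) p%p)
    where
    p%p : (suc k + 1) % p ≡ 0
    p%p = trans (cong (_% p) (+-comm (suc k) 1)) (n%n≡0 p)

  ∣∧<⇒≡0 : ∀ {d} → p ∣ d → d < p → d ≡ 0
  ∣∧<⇒≡0 {zero}  _   _   = refl
  ∣∧<⇒≡0 {suc d} p∣d d<p = ⊥-elim (>⇒∤ d<p p∣d)

  module _ (p-prime : Prime p) {e : ℕ} (e≢0 : e % p ≢ 0) (w : ℕ) where

    residue-injective-≤ : ∀ {a b} → a ≤ b → b < p → (a * e + w) % p ≡ (b * e + w) % p → a ≡ b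
    residue-injective-≤ {a} a≤b b<p eq with m≤n⇒∃[o]m+o≡n a≤b
    ... | d , refl = sym (trans (cong (_+_ a) d≡0) (+-identityʳ a))
      where
      c : ℕ
      c = a * e + w
      regroup : ∀ a d e w → (a + d) * e + w ≡ (a * e + w) + d * e
      regroup = ℕ-Ring.solve-∀
      de%p : 0 ≡ (d * e) % p
      de%p = +-%-cancelˡ c 0 (d * e) (trans (cong (_% p) (+-identityʳ c)) (trans eq (cong (_% p) (regroup a d e w))))
      d≡0 : d ≡ 0
      d≡0 with euclidsLemma d e p-prime (m%n≡0⇒n∣m (d * e) p (sym de%p))
      ... | inj₁ p∣d = ∣∧<⇒≡0 p∣d (≤-<-trans (m≤n+m d a) b<p)
      ... | inj₂ p∣e = ⊥-elim (e≢0 (n∣m⇒m%n≡0 e p p∣e))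

    residue-injective : ∀ (s t : Fin p) → (toℕ s * e + w) % p ≡ (toℕ t * e + w) % p → s ≡ t
    residue-injective s t eq with ≤-total (toℕ s) (toℕ t)
    ... | inj₁ s≤t = Fin.toℕ-injective (residue-injective-≤ s≤t (Fin.toℕ<n t) eq)
    ... | inj₂ t≤s = Fin.toℕ-injective (sym (residue-injective-≤ t≤s (Fin.toℕ<n s) (sym eq)))

    -- The residues form an injective map Fin p → Fin p; if it missed 0 it would inject into Fin (p - 1).
    residue-hits-zero : ∃ λ (t : Fin p) → (toℕ t * e + w) % p ≡ 0
    residue-hits-zero with Fin.any? (λ t → (toℕ t * e + w) % p ≟ 0)
    ... | yes hit = hit
    ... | no miss = ⊥-elim (<-irrefl refl (Fin.injective⇒≤ {f = squeeze} squeeze-injective))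
      where
      residue : Fin p → Fin p
      residue t = fromℕ< (m%n<n (toℕ t * e + w) p)
      toℕ-residue : ∀ t → toℕ (residue t) ≡ (toℕ t * e + w) % p
      toℕ-residue t = Fin.toℕ-fromℕ< (m%n<n (toℕ t * e + w) p)
      residue≢0 : ∀ t → Fin.zero ≢ residue t
      residue≢0 t 0≡r = miss (t , trans (sym (toℕ-residue t)) (sym (cong toℕ 0≡r)))
      squeeze : Fin p → Fin (suc k)
      squeeze t = punchOut (residue≢0 t)
      squeeze-injective : ∀ {s t} → squeeze s ≡ squeeze t → s ≡ t
      squeeze-injective {s} {t} eq = residue-injective s t
        (trans (sym (toℕ-residue s))
          (trans (cong toℕ (Fin.punchOut-injective (residue≢0 s) (residue≢0 t) eq)) (toℕ-residue t)))

    residue-zero-count : ∑[ t ← allFin p ] 𝟙 ((toℕ t * e + w) % p ≡ᵇ 0) ≡ 1ℤ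
    residue-zero-count with residue-hits-zero
    ... | t₀ , hit = ∑-𝟙-unique p _ t₀ (cong (_≡ᵇ 0) hit) λ t P-t →
      residue-injective t t₀ (trans (≡ᵇ⇒≡ _ 0 (subst T (sym P-t) _)) (sym hit))

  centred : ℕ → ℤ
  centred w = + p ℤ.* 𝟙 (w % p ≡ᵇ 0) ℤ.- 1ℤ

  character-sum : Prime p → ∀ e w →
                  ∑[ t ← allFin p ] centred (toℕ t * e + w) ≡ + p ℤ.* 𝟙 (e % p ≡ᵇ 0) ℤ.* centred w
  character-sum p-prime e w with e % p in e%p
  ... | zero = begin
    ∑[ t ← allFin p ] centred (toℕ t * e + w)   ≡⟨ ∑-cong (allFin p) (cong residue-centred ∘ period) ⟩
    ∑[ t ← allFin p ] centred w                 ≡⟨ ∑-const p (centred w) ⟩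
    + p ℤ.* centred w                           ≡⟨ cong (ℤ._* centred w) (ℤ.*-identityʳ (+ p)) ⟨
    + p ℤ.* 1ℤ ℤ.* centred w                    ∎
    where
    open ≡-Reasoning
    residue-centred : ℕ → ℤ
    residue-centred r = + p ℤ.* 𝟙 (r ≡ᵇ 0) ℤ.- 1ℤ
    period : ∀ (t : Fin p) → (toℕ t * e + w) % p ≡ w % p
    period t = %-remove-+ˡ w (∣n⇒∣m*n (toℕ t) (m%n≡0⇒n∣m e p e%p))
  ... | suc _ = begin
    ∑[ t ← allFin p ] centred (toℕ t * e + w)
      ≡⟨ ∑-- (allFin p) (λ t → + p ℤ.* 𝟙 ((toℕ t * e + w) % p ≡ᵇ 0)) (λ _ → 1ℤ) ⟩
    (∑[ t ← allFin p ] + p ℤ.* 𝟙 ((toℕ t * e + w) % p ≡ᵇ 0)) ℤ.- (∑[ t ← allFin p ] 1ℤ)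
      ≡⟨ cong₂ ℤ._-_ (trans (∑-*ˡ (allFin p) (+ p) (λ t → 𝟙 ((toℕ t * e + w) % p ≡ᵇ 0)))
                            (cong (+ p ℤ.*_) (residue-zero-count p-prime {e} e≢0 w)))
                     (∑-const p 1ℤ) ⟩
    + p ℤ.* 1ℤ ℤ.- + p ℤ.* 1ℤ
      ≡⟨ ℤ.+-inverseʳ (+ p ℤ.* 1ℤ) ⟩
    0ℤ
      ≡⟨ cong (ℤ._* centred w) (ℤ.*-zeroʳ (+ p)) ⟨
    + p ℤ.* 0ℤ ℤ.* centred w
      ∎
    where
    open ≡-Reasoning
    e≢0 : e % p ≢ 0
    e≢0 e%p≡0 with () ← trans (sym e%p) e%p≡0


module Rank (k : ℕ) where

  open import Data.Nat using (ℕ; zero; suc; _+_; _*_; _%_; _∸_; _≤_)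
  open import Data.Nat.Properties
  open import Data.Nat.DivMod
  open import Data.Fin as Fin using (Fin; toℕ; fromℕ<; _↑ˡ_; _↑ʳ_; splitAt)
  import Data.Fin.Properties as Fin
  open import Data.Sum using ([_,_]′)
  open import Function using (_∘_)
  open import Relation.Binary.PropositionalEquality
  open Modular k using (p)

  sumFin-cong : ∀ d {f g : Fin d → ℕ} → (∀ i → f i ≡ g i) → sumFin d f ≡ sumFin d g
  sumFin-cong zero    f≗g = refl
  sumFin-cong (suc d) f≗g = cong₂ _+_ (f≗g Fin.zero) (sumFin-cong d (f≗g ∘ Fin.suc))

  sumFin-zero : ∀ d → sumFin d (λ _ → 0) ≡ 0
  sumFin-zero zero    = refl
  sumFin-zero (suc d) = sumFin-zero d

  sumFin-↑ : ∀ d₁ d₂ (f : Fin (d₁ + d₂) → ℕ) →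
             sumFin (d₁ + d₂) f ≡ sumFin d₁ (λ i → f (i ↑ˡ d₂)) + sumFin d₂ (λ j → f (d₁ ↑ʳ j))
  sumFin-↑ zero     d₂ f = refl
  sumFin-↑ (suc d₁) d₂ f =
    trans (cong (f Fin.zero +_) (sumFin-↑ d₁ d₂ (f ∘ Fin.suc))) (sym (+-assoc (f Fin.zero) _ _))

  *-sumFin : ∀ t d (f : Fin d → ℕ) → t * sumFin d f ≡ sumFin d (λ i → t * f i)
  *-sumFin t zero    f = *-zeroʳ t
  *-sumFin t (suc d) f =
    trans (*-distribˡ-+ t (f Fin.zero) _) (cong (t * f Fin.zero +_) (*-sumFin t d (f ∘ Fin.suc)))

  sumFin-% : ∀ d {f g : Fin d → ℕ} → (∀ i → f i % p ≡ g i % p) → sumFin d f % p ≡ sumFin d g % p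
  sumFin-% zero    f≡g = refl
  sumFin-% (suc d) {f} {g} f≡g = begin
    (f Fin.zero + sumFin d (f ∘ Fin.suc)) % p
      ≡⟨ %-distribˡ-+ (f Fin.zero) _ p ⟩
    (f Fin.zero % p + sumFin d (f ∘ Fin.suc) % p) % p
      ≡⟨ cong₂ (λ a b → (a + b) % p) (f≡g Fin.zero) (sumFin-% d (f≡g ∘ Fin.suc)) ⟩
    (g Fin.zero % p + sumFin d (g ∘ Fin.suc) % p) % p
      ≡⟨ %-distribˡ-+ (g Fin.zero) _ p ⟨
    (g Fin.zero + sumFin d (g ∘ Fin.suc)) % p
      ∎
    where open ≡-Reasoning

  record Rank≤ {I : Set} (d : ℕ) (F : I → I → ℕ) : Set where
    constructor factor
    field
      U : I → Fin d → Fin p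
      V : Fin d → I → Fin p
      UV≡F : ∀ x y → prodMat p d U V x y % p ≡ F x y % p

  module _ {I : Set} where

    rank≤-cong : ∀ {d} {F G : I → I → ℕ} → (∀ x y → F x y % p ≡ G x y % p) → Rank≤ d F → Rank≤ d G
    rank≤-cong F≡G (factor U V UV≡F) = factor U V λ x y → trans (UV≡F x y) (F≡G x y)

    rank≤-zero : ∀ d → Rank≤ {I} d (λ _ _ → 0)
    rank≤-zero d = factor (λ _ _ → Fin.zero) (λ _ _ → Fin.zero) λ _ _ → cong (_% p) (sumFin-zero d)

    rank≤-const : ∀ c → Rank≤ {I} 1 (λ _ _ → c)
    rank≤-const c = factor (λ _ _ → c′) (λ _ _ → Fin.suc Fin.zero) λ _ _ → begin
      (toℕ c′ * 1 + 0) % p   ≡⟨ cong (_% p) (trans (+-identityʳ (toℕ c′ * 1)) (*-identityʳ (toℕ c′))) ⟩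
      toℕ c′ % p             ≡⟨ cong (_% p) (Fin.toℕ-fromℕ< (m%n<n c p)) ⟩
      c % p % p              ≡⟨ m%n%n≡m%n c p ⟩
      c % p                  ∎
      where
      open ≡-Reasoning
      c′ : Fin p
      c′ = fromℕ< (m%n<n c p)

    rank≤-+ : ∀ {d₁ d₂} {F G : I → I → ℕ} → Rank≤ d₁ F → Rank≤ d₂ G → Rank≤ (d₁ + d₂) (λ x y → F x y + G x y)
    rank≤-+ {d₁} {d₂} {F} {G} (factor U₁ V₁ U₁V₁≡F) (factor U₂ V₂ U₂V₂≡G) = factor U V UV≡F+G
      where
      U : I → Fin (d₁ + d₂) → Fin p
      U x = [ U₁ x , U₂ x ]′ ∘ splitAt d₁
      V : Fin (d₁ + d₂) → I → Fin p
      V i y = [ (λ a → V₁ a y) , (λ b → V₂ b y) ]′ (splitAt d₁ i)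
      UV≡F+G : ∀ x y → prodMat p (d₁ + d₂) U V x y % p ≡ (F x y + G x y) % p
      UV≡F+G x y = begin
        prodMat p (d₁ + d₂) U V x y % p
          ≡⟨ cong (_% p) (sumFin-↑ d₁ d₂ _) ⟩
        (sumFin d₁ (entry ∘ (_↑ˡ d₂)) + sumFin d₂ (entry ∘ (d₁ ↑ʳ_))) % p
          ≡⟨ cong₂ (λ a b → (a + b) % p)
               (sumFin-cong d₁ (λ i → cong block (Fin.splitAt-↑ˡ d₁ i d₂)))
               (sumFin-cong d₂ (λ j → cong block (Fin.splitAt-↑ʳ d₁ d₂ j))) ⟩
        (prodMat p d₁ U₁ V₁ x y + prodMat p d₂ U₂ V₂ x y) % p
          ≡⟨ %-distribˡ-+ (prodMat p d₁ U₁ V₁ x y) _ p ⟩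
        (prodMat p d₁ U₁ V₁ x y % p + prodMat p d₂ U₂ V₂ x y % p) % p
          ≡⟨ cong₂ (λ a b → (a + b) % p) (U₁V₁≡F x y) (U₂V₂≡G x y) ⟩
        (F x y % p + G x y % p) % p
          ≡⟨ %-distribˡ-+ (F x y) _ p ⟨
        (F x y + G x y) % p
          ∎
        where
        open ≡-Reasoning
        entry : Fin (d₁ + d₂) → ℕ
        entry i = toℕ (U x i) * toℕ (V i y)
        block : _ → ℕ
        block s = toℕ ([ U₁ x , U₂ x ]′ s) * toℕ ([ (λ a → V₁ a y) , (λ b → V₂ b y) ]′ s)

    rank≤-mono : ∀ {d m} {F : I → I → ℕ} → d ≤ m → Rank≤ d F → Rank≤ m F
    rank≤-mono {d} {m} {F} d≤m rank≤d = subst (λ m → Rank≤ m F) (m+[n∸m]≡n d≤m)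
      (rank≤-cong {F = λ x y → F x y + 0} {G = F} (λ x y → cong (_% p) (+-identityʳ (F x y)))
        (rank≤-+ {F = F} {G = λ _ _ → 0} rank≤d (rank≤-zero (m ∸ d))))

    rank≤-scale : ∀ t {d} {F : I → I → ℕ} → Rank≤ d F → Rank≤ d (λ x y → t * F x y)
    rank≤-scale t {d} {F} (factor U V UV≡F) = factor tU V λ x y → begin
      prodMat p d tU V x y % p
        ≡⟨ sumFin-% d (λ i → entry (toℕ (U x i)) (toℕ (V i y))) ⟩
      sumFin d (λ i → t * (toℕ (U x i) * toℕ (V i y))) % p
        ≡⟨ cong (_% p) (*-sumFin t d _) ⟨
      t * prodMat p d U V x y % p
        ≡⟨ %-distribˡ-* t _ p ⟩
      (t % p * (prodMat p d U V x y % p)) % p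
        ≡⟨ cong (λ z → (t % p * z) % p) (UV≡F x y) ⟩
      (t % p * (F x y % p)) % p
        ≡⟨ %-distribˡ-* t _ p ⟨
      t * F x y % p
        ∎
      where
      open ≡-Reasoning
      tU : I → Fin d → Fin p
      tU x i = fromℕ< (m%n<n (t * toℕ (U x i)) p)
      entry : ∀ u v → toℕ (fromℕ< (m%n<n (t * u) p)) * v % p ≡ t * (u * v) % p
      entry u v = begin
        toℕ (fromℕ< (m%n<n (t * u) p)) * v % p   ≡⟨ cong (λ z → z * v % p) (Fin.toℕ-fromℕ< (m%n<n (t * u) p)) ⟩
        t * u % p * v % p                          ≡⟨ %-distribˡ-* (t * u % p) v p ⟩
        (t * u % p % p * (v % p)) % p              ≡⟨ cong (λ z → (z * (v % p)) % p) (m%n%n≡m%n (t * u) p) ⟩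
        (t * u % p * (v % p)) % p                  ≡⟨ %-distribˡ-* (t * u) v p ⟨
        t * u * v % p                              ≡⟨ cong (_% p) (*-assoc t u v) ⟩
        t * (u * v) % p                            ∎

  rank≤-reindex : ∀ {I J : Set} (f : J → I) {d} {F : I → I → ℕ} → Rank≤ d F → Rank≤ d (λ x y → F (f x) (f y))
  rank≤-reindex f (factor U V UV≡F) = factor (λ x → U (f x)) (λ i y → V i (f y)) λ x y → UV≡F (f x) (f y)


module KroneckerApproximation (k : ℕ) (p-prime : Prime (Modular.p k)) {q : ℕ} (A : SMat (Fin q))
  (L : Fin q → Fin q → ℕ) where

  open import Data.Nat as ℕ using (ℕ; zero; suc; _%_; _≡ᵇ_)
  import Data.Nat.Properties as ℕ
  import Data.Nat.Tactic.RingSolver as ℕ-Ring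
  open import Data.Integer as ℤ using (ℤ; +_; 0ℤ; 1ℤ; _+_; _*_; _-_; _^_; _≤_)
  import Data.Integer.Properties as ℤ
  open import Data.Integer.Tactic.RingSolver using (solve-∀)
  open import Data.Bool using (true; false; if_then_else_)
  open import Data.Fin using (Fin; toℕ)
  open import Data.Vec using (Vec; []; _∷_; head; tail)
  open import Data.List using (allFin)
  open import Data.Product using (∃; _×_; _,_)
  open import Relation.Nullary using (yes; no)
  open import Relation.Binary.PropositionalEquality
  open Sums
  open Correlation
  open Modular k
  open Rank k

  -- suc k = p - 1 stands for -1 ∈ 𝔽ₚ: e a b ≡ 0 (mod p) iff L a b ≡ 1, i.e. iff bool(L a b) = +1.
  e : Fin q → Fin q → ℕ
  e a b = suc k ℕ.+ L a b

  W : ∀ {n} → Vec (Fin p) n → Vec (Fin q) n → Vec (Fin q) n → ℕ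
  W []       []      []      = 0
  W (t ∷ ts) (a ∷ x) (b ∷ y) = toℕ t ℕ.* e a b ℕ.+ W ts x y

  gain : ℤ
  gain = ∑∑ (allFin q) (λ a b → toℤ (A a b) * 𝟙 (e a b % p ≡ᵇ 0))

  gain≡plus-mismatches : gain ≡ + entriesEqual A plus - + mismatches (allFin q) p A L
  gain≡plus-mismatches = begin
    gain
      ≡⟨ ∑∑-cong (allFin q) (λ a b → entry (A a b) (L a b)) ⟩
    ∑∑ (allFin q) (λ a b → 𝟙 (A a b == plus) - 𝟙 (if A a b == boolp p (L a b) then false else true))
      ≡⟨ ∑∑-- (allFin q) _ _ ⟩
    ∑∑ (allFin q) (λ a b → 𝟙 (A a b == plus))
      - ∑∑ (allFin q) (λ a b → 𝟙 (if A a b == boolp p (L a b) then false else true))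
      ≡⟨ cong₂ _-_ (countPairs-∑∑ (allFin q) _) (countPairs-∑∑ (allFin q) _) ⟨
    + entriesEqual A plus - + mismatches (allFin q) p A L
      ∎
    where
    open ≡-Reasoning
    entry : ∀ s l → toℤ s * 𝟙 ((suc k ℕ.+ l) % p ≡ᵇ 0) ≡ 𝟙 (s == plus) - 𝟙 (if s == boolp p l then false else true)
    entry s l rewrite [p-1+L]%≡0⇔%≡1 l with l % p ≡ᵇ 1
    entry plus  l | true  = refl
    entry plus  l | false = refl
    entry minus l | true  = refl
    entry minus l | false = refl

  potential : ∀ {n} → Vec (Fin p) n → ℤ
  potential {n} ts = ∑∑ (allVecs q n) (λ x y → toℤ (kron A n x y) * centred (W ts x y))

  module _ {n} (ts : Vec (Fin p) n) where

    slice : Fin p → Fin q → Fin q → ℤ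
    slice t a b = ∑∑ (allVecs q n) (λ x y → toℤ (kron A n x y) * centred (toℕ t ℕ.* e a b ℕ.+ W ts x y))

    ∑-slice : ∀ a b → ∑[ t ← allFin p ] slice t a b ≡ + p * 𝟙 (e a b % p ≡ᵇ 0) * potential ts
    ∑-slice a b = begin
      ∑[ t ← allFin p ] slice t a b
        ≡⟨ ∑-∑∑-comm (allVecs q n) (allFin p) _ ⟩
      ∑∑ (allVecs q n) (λ x y → ∑[ t ← allFin p ] K x y * centred (toℕ t ℕ.* e a b ℕ.+ W ts x y))
        ≡⟨ ∑∑-cong (allVecs q n) (λ x y →
             trans (∑-*ˡ (allFin p) (K x y) (λ t → centred (toℕ t ℕ.* e a b ℕ.+ W ts x y)))
                   (cong (K x y *_) (character-sum p-prime (e a b) (W ts x y)))) ⟩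
      ∑∑ (allVecs q n) (λ x y → K x y * (c * centred (W ts x y)))
        ≡⟨ ∑∑-cong (allVecs q n) (λ x y → swap (K x y) c _) ⟩
      ∑∑ (allVecs q n) (λ x y → c * (K x y * centred (W ts x y)))
        ≡⟨ ∑∑-*ˡ (allVecs q n) c _ ⟩
      c * potential ts
        ∎
      where
      open ≡-Reasoning
      K : Vec (Fin q) n → Vec (Fin q) n → ℤ
      K x y = toℤ (kron A n x y)
      c : ℤ
      c = + p * 𝟙 (e a b % p ≡ᵇ 0)
      swap : ∀ x y z → x * (y * z) ≡ y * (x * z)
      swap = solve-∀

    potential-average : ∑[ t ← allFin p ] potential (t ∷ ts) ≡ + p * gain * potential ts
    potential-average = begin
      ∑[ t ← allFin p ] potential (t ∷ ts)
        ≡⟨ ∑-cong (allFin p) (λ t → ∑∑-kron-suc A n _) ⟩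
      ∑[ t ← allFin p ] ∑∑ (allFin q) (λ a b → toℤ (A a b) * slice t a b)
        ≡⟨ ∑-∑∑-comm (allFin q) (allFin p) _ ⟩
      ∑∑ (allFin q) (λ a b → ∑[ t ← allFin p ] toℤ (A a b) * slice t a b)
        ≡⟨ ∑∑-cong (allFin q) (λ a b →
             trans (∑-*ˡ (allFin p) (toℤ (A a b)) (λ t → slice t a b)) (cong (toℤ (A a b) *_) (∑-slice a b))) ⟩
      ∑∑ (allFin q) (λ a b → toℤ (A a b) * (+ p * 𝟙 (e a b % p ≡ᵇ 0) * potential ts))
        ≡⟨ ∑∑-cong (allFin q) (λ a b → regroup (toℤ (A a b)) (+ p) (𝟙 (e a b % p ≡ᵇ 0)) (potential ts)) ⟩
      ∑∑ (allFin q) (λ a b → + p * (toℤ (A a b) * 𝟙 (e a b % p ≡ᵇ 0)) * potential ts)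
        ≡⟨ ∑∑-*ʳ (allFin q) _ _ ⟩
      ∑∑ (allFin q) (λ a b → + p * (toℤ (A a b) * 𝟙 (e a b % p ≡ᵇ 0))) * potential ts
        ≡⟨ cong (_* potential ts) (∑∑-*ˡ (allFin q) (+ p) _) ⟩
      + p * gain * potential ts
        ∎
      where
      open ≡-Reasoning
      regroup : ∀ s p c E → s * (p * c * E) ≡ p * (s * c) * E
      regroup = solve-∀

  potential-step : 0ℤ ≤ gain → ∀ {n} (ts : Vec (Fin p) n) → + suc k * gain ^ n ≤ potential ts →
                   ∃ λ t → + suc k * gain ^ suc n ≤ potential (t ∷ ts)
  potential-step 0≤gain {n} ts large = ∃-≥-average (suc k) (λ t → potential (t ∷ ts)) (+ suc k * gain ^ suc n) (begin
    + p * (+ suc k * gain ^ suc n)       ≡⟨ regroup (+ p) (+ suc k) gain (gain ^ n) ⟩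
    + p * (gain * (+ suc k * gain ^ n))
      ≤⟨ ℤ.*-monoˡ-≤-nonNeg (+ p) (ℤ.*-monoˡ-≤-nonNeg gain {{ℤ.nonNegative 0≤gain}} large) ⟩
    + p * (gain * potential ts)          ≡⟨ ℤ.*-assoc (+ p) gain (potential ts) ⟨
    + p * gain * potential ts            ≡⟨ potential-average ts ⟨
    ∑[ t ← allFin p ] potential (t ∷ ts) ∎)
    where
    open ℤ.≤-Reasoning
    regroup : ∀ p k g gⁿ → p * (k * (g * gⁿ)) ≡ p * (g * (k * gⁿ))
    regroup = solve-∀

  potential-large : 0ℤ ≤ gain → ∀ n → ∃ λ (ts : Vec (Fin p) n) → + suc k * gain ^ n ≤ potential ts
  potential-large _ zero = [] , ℤ.≤-reflexive (sym potential-[])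
    where
    shift : ∀ K → (1ℤ * ((+ 2 + K) * 1ℤ - 1ℤ) + 0ℤ) + 0ℤ ≡ (1ℤ + K) * 1ℤ
    shift = solve-∀
    potential-[] : potential [] ≡ + suc k * 1ℤ
    potential-[] = begin
      potential []                                ≡⟨⟩
      (1ℤ * (+ p * 1ℤ - 1ℤ) + 0ℤ) + 0ℤ            ≡⟨ cong (λ P → (1ℤ * (P * 1ℤ - 1ℤ) + 0ℤ) + 0ℤ) (ℤ.pos-+ 2 k) ⟩
      (1ℤ * ((+ 2 + + k) * 1ℤ - 1ℤ) + 0ℤ) + 0ℤ    ≡⟨ shift (+ k) ⟩
      (1ℤ + + k) * 1ℤ                             ≡⟨ cong (_* 1ℤ) (ℤ.pos-+ 1 k) ⟨
      + suc k * 1ℤ                                ∎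
      where open ≡-Reasoning
  potential-large 0≤gain (suc n) =
    let ts , large = potential-large 0≤gain n
        t , large′ = potential-step 0≤gain ts large
    in t ∷ ts , large′

  rank≤-shifted-W : ∀ {r} → Rank≤ r L → ∀ {n} (ts : Vec (Fin p) n) c → Rank≤ (n ℕ.* r ℕ.+ 1) (λ x y → c ℕ.+ W ts x y)
  rank≤-shifted-W L-rank [] c =
    rank≤-cong {F = λ _ _ → c} (λ { [] [] → cong (_% p) (sym (ℕ.+-identityʳ c)) }) (rank≤-const c)
  rank≤-shifted-W {r} L-rank {suc n} (t ∷ ts) c =
    subst (λ d → Rank≤ d (λ x y → c ℕ.+ W (t ∷ ts) x y)) (sym (ℕ.+-assoc r (n ℕ.* r) 1))
      (rank≤-cong {F = λ x y → toℕ t ℕ.* L (head x) (head y) ℕ.+ (c′ ℕ.+ W ts (tail x) (tail y))}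
        (λ { (a ∷ x) (b ∷ y) → cong (_% p) (regroup (toℕ t) (L a b) c (suc k) (W ts x y)) })
        (rank≤-+ (rank≤-reindex head (rank≤-scale (toℕ t) L-rank))
                 (rank≤-reindex tail (rank≤-shifted-W L-rank ts c′))))
    where
    c′ : ℕ
    c′ = c ℕ.+ toℕ t ℕ.* suc k
    regroup : ∀ t l c k w → t ℕ.* l ℕ.+ ((c ℕ.+ t ℕ.* k) ℕ.+ w) ≡ c ℕ.+ (t ℕ.* (k ℕ.+ l) ℕ.+ w)
    regroup = ℕ-Ring.solve-∀

  toℤ-boolp-suc : ∀ w → + p * toℤ (boolp p (suc w)) ≡ + 2 * centred w - + k
  toℤ-boolp-suc w rewrite suc-%≡1⇔%≡0 w | ℤ.pos-+ 2 k with w % p ≡ᵇ 0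
  ... | true  = on-zero (+ k)
    where
    on-zero : ∀ K → (+ 2 + K) * 1ℤ ≡ + 2 * ((+ 2 + K) * 1ℤ - 1ℤ) - K
    on-zero = solve-∀
  ... | false = off-zero (+ k)
    where
    off-zero : ∀ K → (+ 2 + K) * ℤ.-1ℤ ≡ + 2 * ((+ 2 + K) * 0ℤ - 1ℤ) - K
    off-zero = solve-∀

  correlation-shifted-W : ∀ {n} (ts : Vec (Fin p) n) →
    + p * correlation (allVecs q n) (kron A n) (λ x y → boolp p (suc (W ts x y))) ≡
    + 2 * potential ts - + k * total A ^ n
  correlation-shifted-W {n} ts = begin
    + p * ∑∑ (allVecs q n) (λ x y → K x y * toℤ (boolp p (suc (W ts x y))))
      ≡⟨ ∑∑-*ˡ (allVecs q n) (+ p) _ ⟨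
    ∑∑ (allVecs q n) (λ x y → + p * (K x y * toℤ (boolp p (suc (W ts x y)))))
      ≡⟨ ∑∑-cong (allVecs q n) (λ x y → trans (swap (+ p) (K x y) _) (cong (K x y *_) (toℤ-boolp-suc (W ts x y)))) ⟩
    ∑∑ (allVecs q n) (λ x y → K x y * (+ 2 * centred (W ts x y) - + k))
      ≡⟨ ∑∑-cong (allVecs q n) (λ x y → distrib (K x y) (centred (W ts x y)) (+ k)) ⟩
    ∑∑ (allVecs q n) (λ x y → + 2 * (K x y * centred (W ts x y)) - + k * K x y)
      ≡⟨ ∑∑-- (allVecs q n) _ _ ⟩
    ∑∑ (allVecs q n) (λ x y → + 2 * (K x y * centred (W ts x y))) - ∑∑ (allVecs q n) (λ x y → + k * K x y)
      ≡⟨ cong₂ _-_ (∑∑-*ˡ (allVecs q n) (+ 2) _)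
                   (trans (∑∑-*ˡ (allVecs q n) (+ k) _) (cong (+ k *_) (total-kron A n))) ⟩
    + 2 * potential ts - + k * total A ^ n
      ∎
    where
    open ≡-Reasoning
    K : Vec (Fin q) n → Vec (Fin q) n → ℤ
    K x y = toℤ (kron A n x y)
    swap : ∀ a b c → a * (b * c) ≡ b * (a * c)
    swap = solve-∀
    distrib : ∀ s ψ k → s * (+ 2 * ψ - k) ≡ + 2 * (s * ψ) - k * s
    distrib = solve-∀

  lower-bound-from-potential : ∀ {g B E c : ℤ} → + p * c ≡ + 2 * E - + k * B → + suc k * g ≤ E → B ≤ g → g ≤ c
  lower-bound-from-potential {g} {B} {E} {c} pc≡ kg≤E B≤g = ℤ.*-cancelˡ-≤-pos g c (+ p) (begin
    + p * g                              ≡⟨ split g ⟩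
    + 2 * (+ suc k * g) - + k * g
      ≤⟨ ℤ.+-mono-≤ (ℤ.*-monoˡ-≤-nonNeg (+ 2) kg≤E) (ℤ.neg-mono-≤ (ℤ.*-monoˡ-≤-nonNeg (+ k) B≤g)) ⟩
    + 2 * E - + k * B                    ≡⟨ pc≡ ⟨
    + p * c                              ∎)
    where
    open ℤ.≤-Reasoning
    split′ : ∀ K g → (+ 2 + K) * g ≡ + 2 * ((1ℤ + K) * g) - K * g
    split′ = solve-∀
    split : ∀ g → + p * g ≡ + 2 * (+ suc k * g) - + k * g
    split g = begin-equality
      + p * g                                ≡⟨ cong (_* g) (ℤ.pos-+ 2 k) ⟩
      (+ 2 + + k) * g                        ≡⟨ split′ (+ k) g ⟩
      + 2 * ((1ℤ + + k) * g) - + k * g       ≡⟨ cong (λ s → + 2 * (s * g) - + k * g) (ℤ.pos-+ 1 k) ⟨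
      + 2 * (+ suc k * g) - + k * g          ∎

  low-rank-correlation : ∀ {r} → Rank≤ r L → 0ℤ ≤ gain → ∀ n →
    ∃ λ (F : Vec (Fin q) n → Vec (Fin q) n → ℕ) →
      Rank≤ (n ℕ.* r ℕ.+ 1) F × gain ^ n ≤ correlation (allVecs q n) (kron A n) (λ x y → boolp p (F x y))
  -- Either the all-ones matrix already correlates well with A^⊗n, or bool(1 + W ts) does.
  low-rank-correlation {r} L-rank 0≤gain n with gain ^ n ℤ.≤? total A ^ n
  ... | yes gⁿ≤totalⁿ =
    (λ _ _ → 1) , rank≤-mono (ℕ.m≤n+m 1 (n ℕ.* r)) (rank≤-const 1) ,
    ℤ.≤-trans gⁿ≤totalⁿ
      (ℤ.≤-reflexive (sym (trans (∑∑-cong (allVecs q n) (λ x y → ℤ.*-identityʳ _)) (total-kron A n))))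
  ... | no gⁿ≰totalⁿ with potential-large 0≤gain n
  ...   | ts , large =
    (λ x y → suc (W ts x y)) , rank≤-shifted-W L-rank ts 1 ,
    lower-bound-from-potential (correlation-shifted-W ts) large (ℤ.<⇒≤ (ℤ.≰⇒> gⁿ≰totalⁿ))


module Rationals where

  open import Data.Nat as ℕ using (ℕ; zero; suc)
  import Data.Nat.Properties as ℕ
  import Data.Nat.Coprimality as Coprime
  open import Data.Integer as ℤ using (ℤ; +_; +[1+_]; -[1+_])
  import Data.Integer.Properties as ℤ
  open import Data.Integer.Tactic.RingSolver using (solve-∀)
  open import Data.Rational using (ℚ; mkℚ; _/_; 0ℚ; 1ℚ; ½; _+_; _*_; _-_; -_; _≤_; _<_; *≤*; ∣_∣; nonNegative)
  import Data.Rational.Properties as ℚ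
  import Data.Rational.Unnormalised as ℚᵘ
  import Data.Rational.Unnormalised.Properties as ℚᵘ
  open import Data.Rational.Solver
  open import Data.Sum using (inj₁; inj₂)
  open import Relation.Binary.PropositionalEquality
  open +-*-Solver

  fromℤ : ℤ → ℚ
  fromℤ i = mkℚ i 0 (Coprime.sym (Coprime.1-coprimeTo ℤ.∣ i ∣))

  ℕtoℚ≡fromℤ : ∀ n → ℕtoℚ n ≡ fromℤ (+ n)
  ℕtoℚ≡fromℤ n = ℚ.↥p/↧p≡p (fromℤ (+ n))

  fromℤ-+ : ∀ i j → fromℤ (i ℤ.+ j) ≡ fromℤ i + fromℤ j
  fromℤ-+ i j = ℚ.toℚᵘ-injective (ℚᵘ.≃-trans (ℚᵘ.*≡* (lemma i j)) (ℚᵘ.≃-sym (ℚ.toℚᵘ-homo-+ (fromℤ i) (fromℤ j))))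
    where
    lemma : ∀ i j → (i ℤ.+ j) ℤ.* + 1 ≡ (i ℤ.* + 1 ℤ.+ j ℤ.* + 1) ℤ.* + 1
    lemma = solve-∀

  fromℤ-* : ∀ i j → fromℤ (i ℤ.* j) ≡ fromℤ i * fromℤ j
  fromℤ-* i j = ℚ.toℚᵘ-injective (ℚᵘ.≃-sym (ℚ.toℚᵘ-homo-* (fromℤ i) (fromℤ j)))

  fromℤ-neg : ∀ i → fromℤ (ℤ.- i) ≡ - fromℤ i
  fromℤ-neg (+ zero)   = refl
  fromℤ-neg +[1+ n ]   = refl
  fromℤ-neg -[1+ n ]   = refl

  fromℤ-- : ∀ i j → fromℤ (i ℤ.- j) ≡ fromℤ i - fromℤ j
  fromℤ-- i j = trans (fromℤ-+ i (ℤ.- j)) (cong (_+_ (fromℤ i)) (fromℤ-neg j))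

  fromℤ-^ : ∀ i n → fromℤ (i ℤ.^ n) ≡ fromℤ i ^ℚ n
  fromℤ-^ i zero    = refl
  fromℤ-^ i (suc n) = trans (fromℤ-* i (i ℤ.^ n)) (cong (fromℤ i *_) (fromℤ-^ i n))

  fromℤ-mono-≤ : ∀ {i j} → i ℤ.≤ j → fromℤ i ≤ fromℤ j
  fromℤ-mono-≤ {i} {j} i≤j = *≤* (subst₂ ℤ._≤_ (sym (ℤ.*-identityʳ i)) (sym (ℤ.*-identityʳ j)) i≤j)

  fromℤ-cancel-≤ : ∀ {i j} → fromℤ i ≤ fromℤ j → i ℤ.≤ j
  fromℤ-cancel-≤ {i} {j} (*≤* i≤j) = subst₂ ℤ._≤_ (ℤ.*-identityʳ i) (ℤ.*-identityʳ j) i≤j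

  ℕtoℚ-nonNeg : ∀ n → 0ℚ ≤ ℕtoℚ n
  ℕtoℚ-nonNeg n = subst (0ℚ ≤_) (sym (ℕtoℚ≡fromℤ n)) (fromℤ-mono-≤ (ℤ.+≤+ ℕ.z≤n))

  ℕtoℚ-* : ∀ m n → ℕtoℚ (m ℕ.* n) ≡ ℕtoℚ m * ℕtoℚ n
  ℕtoℚ-* m n = begin
    ℕtoℚ (m ℕ.* n)           ≡⟨ ℕtoℚ≡fromℤ (m ℕ.* n) ⟩
    fromℤ (+ (m ℕ.* n))      ≡⟨ cong fromℤ (ℤ.pos-* m n) ⟩
    fromℤ (+ m ℤ.* + n)      ≡⟨ fromℤ-* (+ m) (+ n) ⟩
    fromℤ (+ m) * fromℤ (+ n) ≡⟨ cong₂ _*_ (ℕtoℚ≡fromℤ m) (ℕtoℚ≡fromℤ n) ⟨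
    ℕtoℚ m * ℕtoℚ n          ∎
    where open ≡-Reasoning

  ℕtoℚ-^ : ∀ m n → ℕtoℚ (m ℕ.^ n) ≡ ℕtoℚ m ^ℚ n
  ℕtoℚ-^ m zero    = refl
  ℕtoℚ-^ m (suc n) = trans (ℕtoℚ-* m (m ℕ.^ n)) (cong (ℕtoℚ m *_) (ℕtoℚ-^ m n))

  over-* : ∀ n d .{{_ : ℕ.NonZero d}} → (n over d) * fromℤ (+ d) ≡ fromℤ (+ n)
  over-* n (suc d) = ℚ.toℚᵘ-injective (ℚᵘ.≃-trans (ℚ.toℚᵘ-homo-* (+ n / suc d) (fromℤ (+ suc d)))
    (ℚᵘ.≃-trans (ℚᵘ.*-congʳ (ℚ.toℚᵘ-fromℚᵘ (ℚᵘ.mkℚᵘ (+ n) d))) (ℚᵘ.*≡* (lemma (+ n) (+ suc d)))))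
    where
    lemma : ∀ a b → (a ℤ.* b) ℤ.* + 1 ≡ a ℤ.* (b ℤ.* + 1)
    lemma = solve-∀

  0≤*0≤⇒0≤* : ∀ {x y} → 0ℚ ≤ x → 0ℚ ≤ y → 0ℚ ≤ x * y
  0≤*0≤⇒0≤* {x} {y} 0≤x 0≤y =
    ℚ.nonNegative⁻¹ (x * y) {{ℚ.nonNeg*nonNeg⇒nonNeg x {{nonNegative 0≤x}} y {{nonNegative 0≤y}}}}

  ^ℚ-nonNeg : ∀ {x} n → 0ℚ ≤ x → 0ℚ ≤ x ^ℚ n
  ^ℚ-nonNeg zero    0≤x = ℚ.<⇒≤ (ℚ.positive⁻¹ 1ℚ)
  ^ℚ-nonNeg (suc n) 0≤x = 0≤*0≤⇒0≤* 0≤x (^ℚ-nonNeg n 0≤x)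

  ^ℚ-mono-≤ : ∀ {x y} n → 0ℚ ≤ x → x ≤ y → x ^ℚ n ≤ y ^ℚ n
  ^ℚ-mono-≤ zero    0≤x x≤y = ℚ.≤-refl
  ^ℚ-mono-≤ {x} {y} (suc n) 0≤x x≤y = ℚ.≤-trans
    (ℚ.*-monoʳ-≤-nonNeg (x ^ℚ n) {{nonNegative (^ℚ-nonNeg n 0≤x)}} x≤y)
    (ℚ.*-monoˡ-≤-nonNeg y {{nonNegative (ℚ.≤-trans 0≤x x≤y)}} (^ℚ-mono-≤ n 0≤x x≤y))

  ^ℚ-distrib-* : ∀ x y n → (x * y) ^ℚ n ≡ x ^ℚ n * y ^ℚ n
  ^ℚ-distrib-* x y zero    = refl
  ^ℚ-distrib-* x y (suc n) = trans (cong ((x * y) *_) (^ℚ-distrib-* x y n)) (interchange x y (x ^ℚ n) (y ^ℚ n))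
    where
    interchange : ∀ x y a b → (x * y) * (a * b) ≡ (x * a) * (y * b)
    interchange = solve 4 (λ x y a b → (x :* y) :* (a :* b) := (x :* a) :* (y :* b)) refl

  -∣p∣≤p : ∀ p → - ∣ p ∣ ≤ p
  -∣p∣≤p p with ℚ.∣p∣≡p∨∣p∣≡-p p
  ... | inj₁ ∣p∣≡p = ℚ.≤-trans (ℚ.neg-antimono-≤ (ℚ.0≤∣p∣ p)) (subst (0ℚ ≤_) ∣p∣≡p (ℚ.0≤∣p∣ p))
  ... | inj₂ ∣p∣≡-p = ℚ.≤-reflexive (trans (cong -_ ∣p∣≡-p) (involutive p))
    where
    involutive : ∀ p → - (- p) ≡ p
    involutive = solve 1 (λ p → :- (:- p) := p) refl

  ≤-+-nonNeg : ∀ {x y} → 0ℚ ≤ y → x ≤ x + y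
  ≤-+-nonNeg {x} 0≤y = subst (_≤ x + _) (ℚ.+-identityʳ x) (ℚ.+-monoʳ-≤ x 0≤y)

  ½-α-δ-nonNeg : ∀ {α δ} → 0ℚ ≤ α → (α + α) + δ < ½ → 0ℚ ≤ ½ - α - δ
  ½-α-δ-nonNeg {α} {δ} 0≤α small = begin
    0ℚ                           ≡⟨ ℚ.+-inverseʳ s ⟨
    s - s                        ≤⟨ ℚ.+-monoˡ-≤ (- s) (ℚ.<⇒≤ small) ⟩
    ½ - s                        ≤⟨ ≤-+-nonNeg 0≤α ⟩
    (½ - s) + α                  ≡⟨ regroup α δ ⟩
    ½ - α - δ                    ∎
    where
    open ℚ.≤-Reasoning
    s : ℚ
    s = (α + α) + δ
    regroup : ∀ α δ → (½ - ((α + α) + δ)) + α ≡ ½ - α - δ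
    regroup = solve 2 (λ α δ → (con ½ :- ((α :+ α) :+ δ)) :+ α := con ½ :- α :- δ) refl

  balanced-lower-bound : ∀ {P M m fP fM α δ} → fP * (P + M) ≡ P → fM * (P + M) ≡ M →
    0ℚ ≤ P + M → 0ℚ ≤ α → ∣ fP - fM ∣ ≤ α → m ≤ δ * (P + M) → (P + M) * (½ - α - δ) ≤ P - m
  balanced-lower-bound {P} {M} {m} {fP} {fM} {α} {δ} fP-def fM-def 0≤N 0≤α balanced m≤δN = begin
    N * (½ - α - δ)                  ≤⟨ ≤-+-nonNeg (0≤*0≤⇒0≤* (ℚ.<⇒≤ (ℚ.positive⁻¹ ½)) (0≤*0≤⇒0≤* 0≤α 0≤N)) ⟩
    N * (½ - α - δ) + ½ * (α * N)     ≡⟨ regroup₁ P M α δ ⟩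
    ½ * (N + (- α) * N) - δ * N       ≤⟨ ℚ.+-monoˡ-≤ (- (δ * N)) (ℚ.*-monoˡ-≤-nonNeg ½ (ℚ.+-monoʳ-≤ N spread)) ⟩
    ½ * (N + (P - M)) - δ * N         ≡⟨ regroup₂ P M δ ⟩
    P - δ * N                         ≤⟨ ℚ.+-monoʳ-≤ P (ℚ.neg-antimono-≤ m≤δN) ⟩
    P - m                             ∎
    where
    open ℚ.≤-Reasoning
    N : ℚ
    N = P + M
    spread : (- α) * N ≤ P - M
    spread = begin
      (- α) * N
        ≤⟨ ℚ.*-monoʳ-≤-nonNeg N {{nonNegative 0≤N}} (ℚ.≤-trans (ℚ.neg-antimono-≤ balanced) (-∣p∣≤p (fP - fM))) ⟩
      (fP - fM) * N        ≡⟨ ℚ.*-distribʳ-+ N fP (- fM) ⟩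
      fP * N + (- fM) * N  ≡⟨ cong (_+_ (fP * N)) (sym (ℚ.neg-distribˡ-* fM N)) ⟩
      fP * N - fM * N      ≡⟨ cong₂ _-_ fP-def fM-def ⟩
      P - M                ∎
    regroup₁ : ∀ P M α δ → (P + M) * (½ - α - δ) + ½ * (α * (P + M)) ≡ ½ * ((P + M) + (- α) * (P + M)) - δ * (P + M)
    regroup₁ = solve 4 (λ P M α δ → (P :+ M) :* (con ½ :- α :- δ) :+ con ½ :* (α :* (P :+ M))
                                  := con ½ :* ((P :+ M) :+ (:- α) :* (P :+ M)) :- δ :* (P :+ M)) refl
    regroup₂ : ∀ P M δ → ½ * ((P + M) + (P - M)) - δ * (P + M) ≡ P - δ * (P + M)
    regroup₂ = solve 3 (λ P M δ → con ½ :* ((P :+ M) :+ (P :- M)) :- δ :* (P :+ M) := P :- δ :* (P :+ M)) refl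

  half-gap : ∀ {m N : ℕ} {c : ℤ} {x : ℚ} → + (2 ℕ.* m) ≡ + N ℤ.- c → ℕtoℚ N * x ≤ fromℤ c →
             ℕtoℚ m ≤ ℕtoℚ N * (½ - ½ * x)
  half-gap {m} {N} {c} {x} 2m≡N-c Nx≤c = begin
    ℕtoℚ m                          ≡⟨ ℕtoℚ≡fromℤ m ⟩
    fromℤ (+ m)                     ≡⟨ halve (fromℤ (+ m)) ⟩
    ½ * (fromℤ (+ m) + fromℤ (+ m)) ≡⟨ cong (½ *_) (trans (sym (fromℤ-+ (+ m) (+ m))) (cong fromℤ double)) ⟩
    ½ * fromℤ (+ N ℤ.- c)           ≡⟨ cong (½ *_) (trans (fromℤ-- (+ N) c) (cong (_- fromℤ c) (sym (ℕtoℚ≡fromℤ N)))) ⟩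
    ½ * (ℕtoℚ N - fromℤ c)          ≤⟨ ℚ.*-monoˡ-≤-nonNeg ½ (ℚ.+-monoʳ-≤ (ℕtoℚ N) (ℚ.neg-antimono-≤ Nx≤c)) ⟩
    ½ * (ℕtoℚ N - ℕtoℚ N * x)       ≡⟨ factor (ℕtoℚ N) x ⟩
    ℕtoℚ N * (½ - ½ * x)            ∎
    where
    open ℚ.≤-Reasoning
    double : + m ℤ.+ + m ≡ + N ℤ.- c
    double = trans (sym (ℤ.pos-+ m m)) (trans (cong (λ k → + (m ℕ.+ k)) (sym (ℕ.+-identityʳ m))) 2m≡N-c)
    halve : ∀ y → y ≡ ½ * (y + y)
    halve = solve 1 (λ y → y := con ½ :* (y :+ y)) refl
    factor : ∀ N x → ½ * (N - N * x) ≡ N * (½ - ½ * x)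
    factor = solve 2 (λ N x → con ½ :* (N :- N :* x) := N :* (con ½ :- con ½ :* x)) refl


module KroneckerRigidity (k : ℕ) (p-prime : Prime (Modular.p k)) {q : ℕ} (A : SMat (Fin q)) {r : ℕ}
  (U₀ : Fin q → Fin r → Fin (Modular.p k)) (V₀ : Fin r → Fin q → Fin (Modular.p k)) where

  import Data.Nat as ℕ
  import Data.Nat.Properties as ℕ
  open import Data.Integer as ℤ using (ℤ; +_; 0ℤ)
  open import Data.Rational using (ℚ; 0ℚ; ½; _+_; _*_; _-_; _≤_; ∣_∣)
  import Data.Rational.Properties as ℚ
  open import Data.Fin using (Fin)
  open import Data.Vec using (Vec)
  open import Data.List using (allFin)
  open import Data.Product using (_,_)
  open import Relation.Binary.PropositionalEquality
  open Sums
  open Correlation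
  open Modular k using (p; boolp-cong)
  open Rank k
  open Rationals
  open KroneckerApproximation k p-prime A (prodMat p r U₀ V₀)

  gain-lower-bound : ∀ {δ α} .{{_ : ℕ.NonZero q}} → 0ℚ ≤ α →
    ℕtoℚ (mismatches (allFin q) p A (prodMat p r U₀ V₀)) ≤ δ * ℕtoℚ (q ℕ.* q) →
    ∣ (entriesEqual A plus over (q ℕ.* q)) - (entriesEqual A minus over (q ℕ.* q)) ∣ ≤ α →
    ℕtoℚ (q ℕ.* q) * (½ - α - δ) ≤ fromℤ gain
  gain-lower-bound {δ} {α} 0≤α few-mismatches balanced =
    subst₂ _≤_ (cong (_* (½ - α - δ)) P+M≡N) P-m≡gain
      (balanced-lower-bound {fromℤ (+ P#)} {fromℤ (+ M#)} {ℕtoℚ m₁} {P# over (q ℕ.* q)} {M# over (q ℕ.* q)}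
        (over-P+M P#) (over-P+M M#) (subst (0ℚ ≤_) (sym P+M≡N) (ℕtoℚ-nonNeg (q ℕ.* q))) 0≤α balanced
        (subst (λ N → ℕtoℚ m₁ ≤ δ * N) (sym P+M≡N) few-mismatches))
    where
    instance
      q*q≢0 : ℕ.NonZero (q ℕ.* q)
      q*q≢0 = ℕ.m*n≢0 q q
    P# M# m₁ : ℕ
    P# = entriesEqual A plus
    M# = entriesEqual A minus
    m₁ = mismatches (allFin q) p A (prodMat p r U₀ V₀)
    P+M≡N : fromℤ (+ P#) + fromℤ (+ M#) ≡ ℕtoℚ (q ℕ.* q)
    P+M≡N = trans (sym (fromℤ-+ (+ P#) (+ M#)))
                  (trans (cong fromℤ (entries-plus+minus A)) (sym (ℕtoℚ≡fromℤ (q ℕ.* q))))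
    over-P+M : ∀ n → (n over (q ℕ.* q)) * (fromℤ (+ P#) + fromℤ (+ M#)) ≡ fromℤ (+ n)
    over-P+M n = trans (cong ((n over (q ℕ.* q)) *_) (trans P+M≡N (ℕtoℚ≡fromℤ (q ℕ.* q)))) (over-* n (q ℕ.* q))
    P-m≡gain : fromℤ (+ P#) - ℕtoℚ m₁ ≡ fromℤ gain
    P-m≡gain = trans (cong (fromℤ (+ P#) -_) (ℕtoℚ≡fromℤ m₁))
                     (trans (sym (fromℤ-- (+ P#) (+ m₁))) (cong fromℤ (sym gain≡plus-mismatches)))

  rigidity-from-correlation : ∀ {n d} {x : ℚ} (F : Vec (Fin q) n → Vec (Fin q) n → ℕ) → Rank≤ d F →
    ℕtoℚ (q ℕ.^ (2 ℕ.* n)) * x ≤ fromℤ (correlation (allVecs q n) (kron A n) (λ x y → boolp p (F x y))) →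
    RigidityAtMost (allVecs q n) p (kron A n) d (ℕtoℚ (q ℕ.^ (2 ℕ.* n)) * (½ - ½ * x))
  rigidity-from-correlation {n} {d} {x} F (factor U V UV≡F) bound =
    U , V , half-gap {mismatches (allVecs q n) p (kron A n) (prodMat p d U V)} {q ℕ.^ (2 ℕ.* n)} {corr} {x}
                     size-corr bound
    where
    corr : ℤ
    corr = correlation (allVecs q n) (kron A n) (λ x y → boolp p (F x y))
    size-corr : + (2 ℕ.* mismatches (allVecs q n) p (kron A n) (prodMat p d U V)) ≡ + (q ℕ.^ (2 ℕ.* n)) ℤ.- corr
    size-corr = trans
      (2*disagreements≡size-correlation (allVecs q n) (kron A n) (λ x y → boolp p (prodMat p d U V x y)))
      (cong₂ ℤ._-_ (∑∑-one-allVecs q n) (∑∑-cong (allVecs q n) λ x y →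
        cong (λ s → toℤ (kron A n x y) ℤ.* toℤ s) (boolp-cong (prodMat p d U V x y) (F x y) (UV≡F x y))))

  kron-rigidity : ∀ {c : ℚ} {d} → 0ℚ ≤ c → ℕtoℚ (q ℕ.* q) * c ≤ fromℤ gain → ∀ n → n ℕ.* r ℕ.+ 1 ℕ.≤ d →
    RigidityAtMost (allVecs q n) p (kron A n) d (ℕtoℚ (q ℕ.^ (2 ℕ.* n)) * (½ - ½ * c ^ℚ n))
  kron-rigidity {c} {d} 0≤c γ≤gain n nr+1≤d =
    let F , F-rank , gainⁿ≤corr = low-rank-correlation (factor U₀ V₀ λ _ _ → refl) 0≤gain n
    in rigidity-from-correlation F (rank≤-mono nr+1≤d F-rank) (begin
      ℕtoℚ (q ℕ.^ (2 ℕ.* n)) * c ^ℚ n   ≡⟨ cong (_* c ^ℚ n) (trans (cong ℕtoℚ q^2n) (ℕtoℚ-^ (q ℕ.* q) n)) ⟩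
      ℕtoℚ (q ℕ.* q) ^ℚ n * c ^ℚ n       ≡⟨ ^ℚ-distrib-* (ℕtoℚ (q ℕ.* q)) c n ⟨
      (ℕtoℚ (q ℕ.* q) * c) ^ℚ n          ≤⟨ ^ℚ-mono-≤ n 0≤γ γ≤gain ⟩
      fromℤ gain ^ℚ n                    ≡⟨ fromℤ-^ gain n ⟨
      fromℤ (gain ℤ.^ n)                 ≤⟨ fromℤ-mono-≤ gainⁿ≤corr ⟩
      fromℤ (correlation (allVecs q n) (kron A n) (λ x y → boolp p (F x y))) ∎)
    where
    open ℚ.≤-Reasoning
    0≤γ : 0ℚ ≤ ℕtoℚ (q ℕ.* q) * c
    0≤γ = 0≤*0≤⇒0≤* (ℕtoℚ-nonNeg (q ℕ.* q)) 0≤c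
    0≤gain : 0ℤ ℤ.≤ gain
    0≤gain = fromℤ-cancel-≤ (ℚ.≤-trans 0≤γ γ≤gain)
    q^2n : q ℕ.^ (2 ℕ.* n) ≡ (q ℕ.* q) ℕ.^ n
    q^2n = trans (sym (ℕ.^-*-assoc q 2 n)) (cong (λ m → (q ℕ.* m) ℕ.^ n) (ℕ.*-identityʳ q))

open import Data.Nat using (ℕ; suc; _≤_; _*_; _^_)
open import Data.Nat.Primality using (Prime)
open import Data.Fin using (Fin)
open import Data.List using (allFin)
open import Data.Rational using (ℚ; _<_; 0ℚ; 1ℚ; ½; ∣_∣) renaming (_≤_ to _≤ℚ_; _+_ to _+ℚ_; _-_ to _-ℚ_; _*_ to _*ℚ_)
open import Data.Nat using (_+_; >-nonZero)
import Data.Nat.Properties as ℕ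
import Data.Nat.Tactic.RingSolver as ℕ-Ring
open import Data.Nat.Primality using (¬prime[0]; ¬prime[1])
import Data.Rational.Properties as ℚ
open import Data.Product using (_,_)
open import Data.Empty using (⊥-elim)
open import Relation.Binary.PropositionalEquality using (_≡_; subst)

n*r+1≤2*r*n : ∀ {n r} → 1 ≤ n → 1 ≤ r → n * r + 1 ≤ 2 * r * n
n*r+1≤2*r*n {n} {r} 1≤n 1≤r = subst (n * r + 1 ≤_) (double n r) (ℕ.+-monoʳ-≤ (n * r) (ℕ.*-mono-≤ 1≤n 1≤r))
  where
  double : ∀ n r → n * r + n * r ≡ 2 * r * n
  double = ℕ-Ring.solve-∀

theorem1p5 : (p : ℕ) → Prime p → (q : ℕ) → 1 ≤ q → (A : SMat (Fin q))
    → (r : ℕ) → 1 ≤ r → r ≤ q → (δ α : ℚ) → 0ℚ < δ → δ < ½ → 0ℚ < α → α < 1ℚ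
    → RigidityAtMost (allFin q) p A r (δ *ℚ ℕtoℚ (q * q))
    → ∣ (entriesEqual A plus over (q * q)) -ℚ (entriesEqual A minus over (q * q)) ∣ ≤ℚ α
    → (α +ℚ α) +ℚ δ < ½
    → (n : ℕ) → 1 ≤ n
    → RigidityAtMost (allVecs q n) p (kron A n) (2 * r * n)
        (ℕtoℚ (q ^ (2 * n)) *ℚ (½ -ℚ (½ *ℚ ((½ -ℚ α -ℚ δ) ^ℚ n))))
theorem1p5 0 p-prime = ⊥-elim (¬prime[0] p-prime)
theorem1p5 1 p-prime = ⊥-elim (¬prime[1] p-prime)
theorem1p5 (suc (suc k)) p-prime q 1≤q A r 1≤r _ δ α _ _ 0<α _ (U₀ , V₀ , few-mismatches) balanced small n 1≤n =
  kron-rigidity (½-α-δ-nonNeg 0≤α small)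
                (gain-lower-bound {{>-nonZero 1≤q}} 0≤α few-mismatches balanced)
                n (n*r+1≤2*r*n 1≤n 1≤r)
  where
  open KroneckerRigidity k p-prime A U₀ V₀
  open Rationals using (½-α-δ-nonNeg)
  0≤α : 0ℚ ≤ℚ α
  0≤α = ℚ.<⇒≤ 0<α
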